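{- For $n\geq 0$, $$F_{n+1}^I(x,y,q)F_n^I(x,y,q)=\sum_{j=0}^{n}x\,y^{n-j}q^{(n-j)(n+j-1)+j}\left(F_j^I(x,y,q)\right)^2.$$
   Context: $S_n(123,132,213)$ is the set of permutations of $[n]$ with no subsequence order isomorphic to $123$, $132$ or $213$; each such $\pi$ is a concatenation of increasing blocks of size $1$ or $2$, each block larger than all later blocks. $s(\pi)$, $d(\pi)$ are the numbers of maximal increasing runs of $\pi$ of length $1$ and $2$, and $inv(\pi)$ is the number of inversions. $F_n^I(x,y,q)=\sum_{\pi\in S_n(123,132,213)}x^{s(\pi)}y^{d(\pi)}q^{inv(\pi)}$ (so $F_0^I=1$). -}

module Defs where

open import Data.Nat using (ℕ; zero; suc; _<ᵇ_; _≡ᵇ_)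
open import Data.Bool using (Bool; true; false; not; _∧_; if_then_else_)
open import Data.List using (List; []; _∷_; _++_; map; concatMap; filter; upTo; foldr; length)
open import Data.Product using (_×_; _,_)
open import Relation.Nullary.Decidable using (does)
open import Relation.Binary.PropositionalEquality using (_≡_; refl)
open import Data.Bool.Properties using () renaming (_≟_ to _≟ᵇ_)
open import Algebra.Bundles using (CommutativeSemiring)

-- Permutations of [n] = {1,…,n} in one-line notation, as lists of ℕ.

words : ℕ → ℕ → List (List ℕ)
words zero    n = [] ∷ []
words (suc k) n = concatMap (λ w → map (λ a → a ∷ w) (map suc (upTo n))) (words k n)

elemᵇ : ℕ → List ℕ → Bool
elemᵇ a []      = false
elemᵇ a (b ∷ w) = (a ≡ᵇ b) Data.Bool.∨ elemᵇ a w

distinctᵇ : List ℕ → Bool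
distinctᵇ []      = true
distinctᵇ (a ∷ w) = not (elemᵇ a w) ∧ distinctᵇ w

perms : ℕ → List (List ℕ)
perms n = filter (λ w → distinctᵇ w ≟ᵇ true) (words n n)

pairs : List ℕ → List (ℕ × ℕ)
pairs []      = []
pairs (a ∷ w) = map (λ b → (a , b)) w ++ pairs w

triples : List ℕ → List (ℕ × ℕ × ℕ)
triples []      = []
triples (a ∷ w) = map (λ { (b , c) → (a , b , c) }) (pairs w) ++ triples w

allᵇ : {A : Set} → (A → Bool) → List A → Bool
allᵇ p []      = true
allᵇ p (a ∷ w) = p a ∧ allᵇ p w

is123 is132 is213 : ℕ × ℕ × ℕ → Bool
is123 (a , b , c) = (a <ᵇ b) ∧ (b <ᵇ c)
is132 (a , b , c) = (a <ᵇ c) ∧ (c <ᵇ b)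
is213 (a , b , c) = (b <ᵇ a) ∧ (a <ᵇ c)

avoidsᵇ : List ℕ → Bool
avoidsᵇ π = allᵇ (λ t → not (is123 t Data.Bool.∨ is132 t Data.Bool.∨ is213 t)) (triples π)

S : ℕ → List (List ℕ)
S n = filter (λ π → avoidsᵇ π ≟ᵇ true) (perms n)

countᵇ : {A : Set} → (A → Bool) → List A → ℕ
countᵇ p []      = 0
countᵇ p (a ∷ w) = if p a then suc (countᵇ p w) else countᵇ p w

runsFrom : ℕ → ℕ → List ℕ → List ℕ
runsFrom prev len []      = len ∷ []
runsFrom prev len (b ∷ w) = if prev <ᵇ b then runsFrom b (suc len) w
                                         else len ∷ runsFrom b 1 w

runs : List ℕ → List ℕ
runs []      = []
runs (a ∷ w) = runsFrom a 1 w

sstat dstat : List ℕ → ℕ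
sstat π = countᵇ (λ l → l ≡ᵇ 1) (runs π)
dstat π = countᵇ (λ l → l ≡ᵇ 2) (runs π)

inv : List ℕ → ℕ
inv π = countᵇ (λ { (a , b) → b <ᵇ a }) (pairs π)

-- Generating polynomial, evaluated in an arbitrary commutative semiring
-- (an identity for all evaluations in all commutative semirings is the
-- same as an identity of polynomials in ℤ[x,y,q]/ℕ[x,y,q]).

module _ {c ℓ} (R : CommutativeSemiring c ℓ) where
  open CommutativeSemiring R

  pow : Carrier → ℕ → Carrier
  pow a zero    = 1#
  pow a (suc k) = a * pow a k

  sumL : List Carrier → Carrier
  sumL = foldr _+_ 0#

  FI : ℕ → Carrier → Carrier → Carrier → Carrier
  FI n x y q = sumL (map (λ π → pow x (sstat π) * pow y (dstat π) * pow q (inv π)) (S n))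

-- An avoider of length n + 2 begins either with its maximum n + 2 or with the block n + 1, n + 2:
-- otherwise its first entry forms a 123 or 132 pattern with n + 1 and n + 2, or it is n + 1 and
-- forms a 213 pattern with the second entry and n + 2. Reading off the statistics of the two kinds
-- of avoiders gives the recurrence
--   F(n+2) = x q^(n+1) F(n+1) + y q^(2n) F(n),   F(0) = 1,   F(1) = x,
-- and the identity follows from the recurrence alone, by induction on n: multiplying the
-- identity for n by y q^(2n) shifts every term of its right-hand side to the term with the same
-- j for n + 1, and x q^(n+1) F(n+1)² is the new term j = n + 1.
module Submission where

open import Defs
open import Algebra.Bundles using (CommutativeSemiring)
open import Data.Bool using (Bool; true; false; not; _∨_)
open import Data.Bool.Properties using (T-≡; ∨-zeroʳ)
open import Data.List using (List; []; _∷_; _++_; map; concatMap; upTo; length; cartesianProductWith)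
open import Data.List.Properties using (map-++; map-∘; upTo-∷ʳ; length-map; length-upTo; ∷-injective)
open import Data.List.Membership.Propositional using (_∈_; _∉_)
open import Data.List.Membership.Propositional.Properties
  using (∈-++⁺ˡ; ∈-++⁺ʳ; ∈-++⁻; ∈-map⁺; ∈-map⁻; ∈-∃++; ∈-upTo⁺; ∈-upTo⁻; ∈-filter⁺; ∈-filter⁻;
         ∈-cartesianProductWith⁺; ∈-cartesianProductWith⁻)
open import Data.List.Membership.Propositional.Properties.WithK using (unique∧set⇒bag)
open import Data.List.Relation.Binary.BagAndSetEquality using (∼bag⇒↭)
open import Data.List.Relation.Binary.Permutation.Propositional using (_↭_; ↭⇒↭ₛ′)
open import Data.List.Relation.Binary.Permutation.Propositional.Properties using (map⁺; shift; ↭-length; ∈-resp-↭)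
import Data.List.Relation.Binary.Permutation.Setoid.Properties as SetoidPermutation
open import Data.List.Relation.Unary.All as All using (All; []; _∷_)
open import Data.List.Relation.Unary.All.Properties using (¬Any⇒All¬; All¬⇒¬Any)
open import Data.List.Relation.Unary.AllPairs using ([]; _∷_)
open import Data.List.Relation.Unary.Any using (here; there)
open import Data.List.Relation.Unary.Unique.Propositional using (Unique)
import Data.List.Relation.Unary.Unique.Propositional.Properties as Unique
open import Data.Nat using (ℕ; zero; suc; _∸_; _≤_; _<_; z≤n; s≤s; _<ᵇ_; _≡ᵇ_)
  renaming (_+_ to _+ℕ_; _*_ to _*ℕ_)
open import Data.Nat.Properties
  using (_≟_; <⇒<ᵇ; <ᵇ⇒<; ≡ᵇ⇒≡; ≡⇒≡ᵇ; <⇒≤; ≤-refl; <-trans; n<1+n; n≤1+n; m≤n⇒m≤1+n; <⇒≢; ≤∧≢⇒<;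
         ≤-pred; <-irrefl; ≤⇒≯; suc-injective; n∸n≡0; m+n∸m≡n; +-suc; m≤n⇒∃[o]m+o≡n; +-∸-assoc;
         module ≤-Reasoning)
open import Data.List.Membership.DecPropositional _≟_ using (_∈?_)
open import Data.Nat.Solver using (module +-*-Solver)
open import Data.Product using (_×_; _,_; proj₁; proj₂; ∃)
import Data.Product as Product
open import Data.Sum using (_⊎_; inj₁; inj₂)
import Data.Sum as Sum
open import Function using (_∘_; _⇔_; mk⇔; Equivalence)
open import Relation.Nullary using (¬_; yes; no; contradiction)
open import Relation.Binary.PropositionalEquality
  using (_≡_; _≢_; refl; sym; trans; cong; cong₂; subst; subst₂; module ≡-Reasoning)

<ᵇ-true : ∀ {m n} → m < n → (m <ᵇ n) ≡ true
<ᵇ-true = Equivalence.to T-≡ ∘ <⇒<ᵇ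

<ᵇ-false : ∀ {m n} → n ≤ m → (m <ᵇ n) ≡ false
<ᵇ-false {m} {n} n≤m with m <ᵇ n in eq
... | false = refl
... | true  = contradiction (<ᵇ⇒< m n (Equivalence.from T-≡ eq)) (≤⇒≯ n≤m)

≤-pred-≢ : ∀ {m z} → z ≤ suc m → suc m ≢ z → z ≤ m
≤-pred-≢ z≤ ≢z = ≤-pred (≤∧≢⇒< z≤ (≢z ∘ sym))

∈-tail : ∀ {A : Set} {x y : A} {ys} → x ∈ y ∷ ys → y ≢ x → x ∈ ys
∈-tail (here x≡y) y≢x = contradiction (sym x≡y) y≢x
∈-tail (there x∈ys) _ = x∈ys

module _ {A : Set} where

  allᵇ-true⁻ : ∀ (p : A → Bool) xs → allᵇ p xs ≡ true → ∀ {t} → t ∈ xs → p t ≡ true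
  allᵇ-true⁻ p (a ∷ xs) h (here refl) with p a
  ... | true = refl
  allᵇ-true⁻ p (a ∷ xs) h (there t∈) with p a
  ... | true = allᵇ-true⁻ p xs h t∈

  allᵇ-true⁺ : ∀ (p : A → Bool) xs → (∀ {t} → t ∈ xs → p t ≡ true) → allᵇ p xs ≡ true
  allᵇ-true⁺ p []       h = refl
  allᵇ-true⁺ p (a ∷ xs) h rewrite h (here refl) = allᵇ-true⁺ p xs (h ∘ there)

  countᵇ-++ : ∀ (p : A → Bool) xs ys → countᵇ p (xs ++ ys) ≡ countᵇ p xs +ℕ countᵇ p ys
  countᵇ-++ p []       ys = refl
  countᵇ-++ p (a ∷ xs) ys with p a
  ... | true  = cong suc (countᵇ-++ p xs ys)
  ... | false = countᵇ-++ p xs ys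

  countᵇ-map : ∀ {B : Set} (p : B → Bool) (f : A → B) xs → countᵇ p (map f xs) ≡ countᵇ (p ∘ f) xs
  countᵇ-map p f []       = refl
  countᵇ-map p f (a ∷ xs) with p (f a)
  ... | true  = cong suc (countᵇ-map p f xs)
  ... | false = countᵇ-map p f xs

  countᵇ-all : ∀ (p : A → Bool) {xs} → All (λ t → p t ≡ true) xs → countᵇ p xs ≡ length xs
  countᵇ-all p []                 = refl
  countᵇ-all p (pa ∷ ps) rewrite pa = cong suc (countᵇ-all p ps)

  Unique-⊆⇒length≤ : ∀ {xs ys : List A} → Unique xs → All (_∈ ys) xs → length xs ≤ length ys
  Unique-⊆⇒length≤ {[]}     _              _                  = z≤n
  Unique-⊆⇒length≤ {x ∷ xs} (x∉xs ∷ uxs) (x∈ys ∷ xs⊆ys) with ∈-∃++ x∈ys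
  ... | ys₁ , ys₂ , refl = begin
    suc (length xs)             ≤⟨ s≤s (Unique-⊆⇒length≤ uxs (All.zipWith remove (x∉xs , xs⊆ys))) ⟩
    suc (length (ys₁ ++ ys₂))   ≡⟨ ↭-length (shift x ys₁ ys₂) ⟨
    length (ys₁ ++ x ∷ ys₂)     ∎
    where
    open ≤-Reasoning
    remove : ∀ {z} → x ≢ z × z ∈ ys₁ ++ x ∷ ys₂ → z ∈ ys₁ ++ ys₂
    remove (x≢z , z∈) = ∈-tail (∈-resp-↭ (shift x ys₁ ys₂) z∈) x≢z

concatMap≡cartesianProductWith : ∀ {A B C : Set} (f : A → B → C) xs ys →
                concatMap (λ x → map (f x) ys) xs ≡ cartesianProductWith f xs ys
concatMap≡cartesianProductWith f []       ys = refl
concatMap≡cartesianProductWith f (x ∷ xs) ys = cong (map (f x) ys ++_) (concatMap≡cartesianProductWith f xs ys)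

-- Pairs, triples and pattern avoidance

pairs-∈ : ∀ w {b c} → (b , c) ∈ pairs w → b ∈ w × c ∈ w
pairs-∈ (a ∷ w) bc∈ with ∈-++⁻ (map (a ,_) w) bc∈
... | inj₂ bc∈w = Product.map there there (pairs-∈ w bc∈w)
... | inj₁ ac∈ with ∈-map⁻ (a ,_) ac∈
...   | _ , c∈w , refl = here refl , there c∈w

pairs-∷⁻ : ∀ a w {b c} → (b , c) ∈ pairs (a ∷ w) → (b ≡ a × c ∈ w) ⊎ (b , c) ∈ pairs w
pairs-∷⁻ a w bc∈ with ∈-++⁻ (map (a ,_) w) bc∈
... | inj₂ bc∈w = inj₂ bc∈w
... | inj₁ ac∈ with ∈-map⁻ (a ,_) ac∈
...   | _ , c∈w , refl = inj₁ (refl , c∈w)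

pairs-∷⁺ : ∀ a {w c} → c ∈ w → (a , c) ∈ pairs (a ∷ w)
pairs-∷⁺ a c∈w = ∈-++⁺ˡ (∈-map⁺ (a ,_) c∈w)

pairs-either : ∀ w {u v} → u ∈ w → v ∈ w → u ≢ v → (u , v) ∈ pairs w ⊎ (v , u) ∈ pairs w
pairs-either (a ∷ w) (here refl) (here refl) u≢v = contradiction refl u≢v
pairs-either (a ∷ w) (here refl) (there v∈) _   = inj₁ (pairs-∷⁺ a v∈)
pairs-either (a ∷ w) (there u∈) (here refl) _   = inj₂ (pairs-∷⁺ a u∈)
pairs-either (a ∷ w) (there u∈) (there v∈) u≢v =
  Sum.map (∈-++⁺ʳ _) (∈-++⁺ʳ _) (pairs-either w u∈ v∈ u≢v)

triples-∷⁺ : ∀ a w {b c} → (b , c) ∈ pairs w → (a , b , c) ∈ triples (a ∷ w)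
triples-∷⁺ a w bc∈ = ∈-++⁺ˡ (∈-map⁺ _ bc∈)

allowed : ℕ × ℕ × ℕ → Bool
allowed t = not (is123 t ∨ is132 t ∨ is213 t)

-- A record rather than `avoidsᵇ π ≡ true`, so that π can be inferred from the type.
record Avoids (π : List ℕ) : Set where
  constructor avoids
  field avoidsᵇ≡true : avoidsᵇ π ≡ true

allowed-max : ∀ {a b c} → b < a → c < a → allowed (a , b , c) ≡ true
allowed-max b<a c<a rewrite <ᵇ-false (<⇒≤ b<a) | <ᵇ-false (<⇒≤ c<a) | <ᵇ-true b<a = refl

allowed-231 : ∀ {a c} → c < a → allowed (a , suc a , c) ≡ true
allowed-231 {a} c<a
  rewrite <ᵇ-true (n<1+n a) | <ᵇ-false (m≤n⇒m≤1+n (<⇒≤ c<a)) | <ᵇ-false (<⇒≤ c<a) | <ᵇ-false (n≤1+n a)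
  = refl

allowed-123 : ∀ {a b c} → a < b → b < c → allowed (a , b , c) ≡ false
allowed-123 a<b b<c rewrite <ᵇ-true a<b | <ᵇ-true b<c = refl

allowed-132 : ∀ {a b c} → a < c → c < b → allowed (a , b , c) ≡ false
allowed-132 a<c c<b rewrite <ᵇ-true (<-trans a<c c<b) | <ᵇ-false (<⇒≤ c<b) | <ᵇ-true a<c | <ᵇ-true c<b = refl

allowed-213 : ∀ {a b c} → b < a → a < c → allowed (a , b , c) ≡ false
allowed-213 b<a a<c
  rewrite <ᵇ-false (<⇒≤ b<a) | <ᵇ-true a<c | <ᵇ-false (<⇒≤ (<-trans b<a a<c)) | <ᵇ-true b<a = refl

avoids-∈ : ∀ {π t} → Avoids π → t ∈ triples π → allowed t ≡ true
avoids-∈ {π} (avoids av) = allᵇ-true⁻ allowed (triples π) av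

avoids-∌ : ∀ {π t} → Avoids π → allowed t ≡ false → t ∉ triples π
avoids-∌ av t-forbidden t∈ with () ← trans (sym t-forbidden) (avoids-∈ av t∈)

avoids-tail : ∀ {a w} → Avoids (a ∷ w) → Avoids w
avoids-tail {a} {w} av = avoids (allᵇ-true⁺ allowed (triples w) (avoids-∈ av ∘ ∈-++⁺ʳ _))

avoids-∷ : ∀ {a w} → Avoids w → (∀ {b c} → (b , c) ∈ pairs w → allowed (a , b , c) ≡ true) → Avoids (a ∷ w)
avoids-∷ {a} {w} av ok = avoids (allᵇ-true⁺ allowed (triples (a ∷ w)) allowed-∈)
  where
  allowed-∈ : ∀ {t} → t ∈ triples (a ∷ w) → allowed t ≡ true
  allowed-∈ t∈ with ∈-++⁻ (map _ (pairs w)) t∈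
  ... | inj₂ t∈w = avoids-∈ av t∈w
  ... | inj₁ t∈a with ∈-map⁻ _ t∈a
  ...   | _ , bc∈ , refl = ok bc∈

avoids-max-∷ : ∀ {m w} → All (_< m) w → Avoids w → Avoids (m ∷ w)
avoids-max-∷ {w = w} w<m av = avoids-∷ av λ bc∈ →
  let b∈ , c∈ = pairs-∈ w bc∈ in allowed-max (All.lookup w<m b∈) (All.lookup w<m c∈)

-- Runs and inversions after a large first entry

runsFrom-below : ∀ {m l σ} → All (_< m) σ → runsFrom m l σ ≡ l ∷ runs σ
runsFrom-below []           = refl
runsFrom-below (a<m ∷ _) rewrite <ᵇ-false (<⇒≤ a<m) = refl

runs-max-∷ : ∀ {m σ} → All (_< m) σ → runs (m ∷ σ) ≡ 1 ∷ runs σ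
runs-max-∷ = runsFrom-below

runs-rise-∷ : ∀ {k σ} → All (_< suc k) σ → runs (k ∷ suc k ∷ σ) ≡ 2 ∷ runs σ
runs-rise-∷ {k} σ<k+1 rewrite <ᵇ-true (n<1+n k) = runsFrom-below σ<k+1

inv-∷ : ∀ a w → inv (a ∷ w) ≡ countᵇ (_<ᵇ a) w +ℕ inv w
inv-∷ a w = trans (countᵇ-++ _ (map (a ,_) w) (pairs w)) (cong (_+ℕ inv w) (countᵇ-map _ (a ,_) w))

inv-max-∷ : ∀ {m σ} → All (_< m) σ → inv (m ∷ σ) ≡ length σ +ℕ inv σ
inv-max-∷ {m} {σ} σ<m = trans (inv-∷ m σ) (cong (_+ℕ inv σ) (countᵇ-all (_<ᵇ m) (All.map <ᵇ-true σ<m)))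

inv-rise-∷ : ∀ {k σ} → All (_< k) σ → inv (k ∷ suc k ∷ σ) ≡ length σ +ℕ (length σ +ℕ inv σ)
inv-rise-∷ {k} {σ} σ<k rewrite inv-∷ k (suc k ∷ σ) | <ᵇ-false (n≤1+n k)
                             | countᵇ-all (_<ᵇ k) (All.map <ᵇ-true σ<k)
                             | inv-max-∷ (All.map m≤n⇒m≤1+n σ<k) = refl

-- Permutations avoiding 123, 132 and 213

oneTo : ℕ → List ℕ
oneTo n = map suc (upTo n)

∈-oneTo⁺ : ∀ {n z} → 1 ≤ z × z ≤ n → z ∈ oneTo n
∈-oneTo⁺ {z = suc z} (_ , z<n) = ∈-map⁺ suc (∈-upTo⁺ z<n)

∈-oneTo⁻ : ∀ {n z} → z ∈ oneTo n → 1 ≤ z × z ≤ n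
∈-oneTo⁻ z∈ with ∈-map⁻ suc z∈
... | _ , z∈upTo , refl = s≤s z≤n , ∈-upTo⁻ z∈upTo

length-oneTo : ∀ n → length (oneTo n) ≡ n
length-oneTo n = trans (length-map suc (upTo n)) (length-upTo n)

words-suc : ∀ k n → words (suc k) n ≡ cartesianProductWith (λ w a → a ∷ w) (words k n) (oneTo n)
words-suc k n = concatMap≡cartesianProductWith (λ w a → a ∷ w) (words k n) (oneTo n)

words-unique : ∀ k n → Unique (words k n)
words-unique zero    n = [] ∷ []
words-unique (suc k) n = subst Unique (sym (words-suc k n))
  (Unique.cartesianProductWith⁺ (λ w a → a ∷ w) (Product.swap ∘ ∷-injective)
    (words-unique k n) (Unique.map⁺ suc-injective (Unique.upTo⁺ n)))

∈-words⁺ : ∀ {k n w} → length w ≡ k → All (_∈ oneTo n) w → w ∈ words k n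
∈-words⁺ {zero}      {w = []}    refl []           = here refl
∈-words⁺ {suc k} {n} {w = a ∷ w} refl (a∈ ∷ w⊆) = subst (a ∷ w ∈_) (sym (words-suc k n))
  (∈-cartesianProductWith⁺ (λ w a → a ∷ w) (∈-words⁺ refl w⊆) a∈)

∈-words⁻ : ∀ {k n w} → w ∈ words k n → length w ≡ k × All (_∈ oneTo n) w
∈-words⁻ {zero}      (here refl) = refl , []
∈-words⁻ {suc k} {n} w∈
  with ∈-cartesianProductWith⁻ (λ w a → a ∷ w) (words k n) (oneTo n) (subst (_ ∈_) (words-suc k n) w∈)
... | v , a , v∈ , a∈ , refl = Product.map (cong suc) (a∈ ∷_) (∈-words⁻ v∈)

∈⇒elemᵇ : ∀ {a w} → a ∈ w → elemᵇ a w ≡ true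
∈⇒elemᵇ {a} (here refl) rewrite Equivalence.to T-≡ (≡⇒≡ᵇ a a refl) = refl
∈⇒elemᵇ {a} {b ∷ w} (there a∈w) rewrite ∈⇒elemᵇ a∈w = ∨-zeroʳ (a ≡ᵇ b)

elemᵇ⇒∈ : ∀ {a} w → elemᵇ a w ≡ true → a ∈ w
elemᵇ⇒∈ {a} (b ∷ w) h with a ≡ᵇ b in eq
... | true  = here (≡ᵇ⇒≡ a b (Equivalence.from T-≡ eq))
... | false = there (elemᵇ⇒∈ w h)

elemᵇ-false⇒∉ : ∀ {a w} → elemᵇ a w ≡ false → a ∉ w
elemᵇ-false⇒∉ a∉w a∈w with () ← trans (sym a∉w) (∈⇒elemᵇ a∈w)

distinctᵇ⇔Unique : ∀ w → distinctᵇ w ≡ true ⇔ Unique w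
distinctᵇ⇔Unique w = mk⇔ (to w) (from w)
  where
  to : ∀ w → distinctᵇ w ≡ true → Unique w
  to []      _ = []
  to (a ∷ w) h with elemᵇ a w in eq
  ... | false = ¬Any⇒All¬ w (elemᵇ-false⇒∉ eq) ∷ to w h
  from : ∀ w → Unique w → distinctᵇ w ≡ true
  from []        _            = refl
  from (a ∷ w) (a∉w ∷ uw) with elemᵇ a w in eq
  ... | true  = contradiction (elemᵇ⇒∈ w eq) (All¬⇒¬Any a∉w)
  ... | false = from w uw

record IsAvoider (n : ℕ) (σ : List ℕ) : Set where
  constructor isAvoider
  field
    length≡  : length σ ≡ n
    bounded  : All (λ z → 1 ≤ z × z ≤ n) σ
    unique   : Unique σ
    avoiding : Avoids σ

∈-S⇔IsAvoider : ∀ {n σ} → σ ∈ S n ⇔ IsAvoider n σ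
∈-S⇔IsAvoider {n} {σ} = mk⇔ to from
  where
  to : σ ∈ S n → IsAvoider n σ
  to σ∈ with ∈-filter⁻ _ {xs = perms n} σ∈
  ... | σ∈perms , av with ∈-filter⁻ _ {xs = words n n} σ∈perms
  ...   | σ∈words , dist with ∈-words⁻ σ∈words
  ...     | len , σ⊆ = isAvoider len (All.map ∈-oneTo⁻ σ⊆) (Equivalence.to (distinctᵇ⇔Unique σ) dist) (avoids av)
  from : IsAvoider n σ → σ ∈ S n
  from (isAvoider len bnd u (avoids av)) =
    ∈-filter⁺ _ (∈-filter⁺ _ (∈-words⁺ len (All.map ∈-oneTo⁺ bnd)) (Equivalence.from (distinctᵇ⇔Unique σ) u)) av

S-unique : ∀ n → Unique (S n)
S-unique n = Unique.filter⁺ _ (Unique.filter⁺ _ (words-unique n n))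

IsAvoider-∋ : ∀ {n σ v} → IsAvoider n σ → 1 ≤ v → v ≤ n → v ∈ σ
IsAvoider-∋ {n} {σ} {v} (isAvoider len bnd u _) 1≤v v≤n with v ∈? σ
... | yes v∈σ = v∈σ
... | no  v∉σ = contradiction (subst₂ _≤_ (cong suc len) (length-oneTo n) too-long) (<-irrefl refl)
  where
  too-long : length (v ∷ σ) ≤ length (oneTo n)
  too-long = Unique-⊆⇒length≤ (¬Any⇒All¬ σ v∉σ ∷ u)
                               (All.map ∈-oneTo⁺ ((1≤v , v≤n) ∷ bnd))

bounded-below : ∀ {n σ} → All (λ z → 1 ≤ z × z ≤ n) σ → All (_< suc n) σ
bounded-below = All.map (s≤s ∘ proj₂)

bounded-drop : ∀ {m σ} → All (λ z → 1 ≤ z × z ≤ suc m) σ → All (suc m ≢_) σ → All (λ z → 1 ≤ z × z ≤ m) σ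
bounded-drop bnd ≢σ = All.zipWith (λ ((1≤z , z≤) , ≢z) → 1≤z , ≤-pred-≢ z≤ ≢z) (bnd , ≢σ)

bounded-weaken : ∀ {m σ} → All (λ z → 1 ≤ z × z ≤ m) σ → All (λ z → 1 ≤ z × z ≤ suc m) σ
bounded-weaken = All.map (Product.map₂ m≤n⇒m≤1+n)

below⇒∉ : ∀ {m σ} → All (_< m) σ → All (m ≢_) σ
below⇒∉ = All.map (λ z<m m≡z → <-irrefl (sym m≡z) z<m)

IsAvoider-max⁺ : ∀ {n τ} → IsAvoider n τ → IsAvoider (suc n) (suc n ∷ τ)
IsAvoider-max⁺ (isAvoider len bnd u av) =
  isAvoider (cong suc len) ((s≤s z≤n , ≤-refl) ∷ bounded-weaken bnd) (below⇒∉ (bounded-below bnd) ∷ u)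
            (avoids-max-∷ (bounded-below bnd) av)

IsAvoider-rise⁺ : ∀ {n τ} → IsAvoider n τ → IsAvoider (suc (suc n)) (suc n ∷ suc (suc n) ∷ τ)
IsAvoider-rise⁺ {n} {τ} (isAvoider len bnd u av) =
  isAvoider (cong (suc ∘ suc) len)
            ((s≤s z≤n , n≤1+n (suc n)) ∷ (s≤s z≤n , ≤-refl) ∷ bounded-weaken (bounded-weaken bnd))
            ((<⇒≢ (n<1+n (suc n)) ∷ below⇒∉ τ<n+1) ∷ below⇒∉ τ<n+2 ∷ u)
            (avoids-∷ (avoids-max-∷ τ<n+2 av) ok)
  where
  τ<n+1 : All (_< suc n) τ
  τ<n+1 = bounded-below bnd
  τ<n+2 : All (_< suc (suc n)) τ
  τ<n+2 = All.map m≤n⇒m≤1+n τ<n+1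
  ok : ∀ {b c} → (b , c) ∈ pairs (suc (suc n) ∷ τ) → allowed (suc n , b , c) ≡ true
  ok bc∈ with pairs-∷⁻ (suc (suc n)) τ bc∈
  ... | inj₁ (refl , c∈τ) = allowed-231 (All.lookup τ<n+1 c∈τ)
  ... | inj₂ bc∈τ = let b∈ , c∈ = pairs-∈ τ bc∈τ in allowed-max (All.lookup τ<n+1 b∈) (All.lookup τ<n+1 c∈)

IsAvoider-max⁻ : ∀ {n τ} → IsAvoider (suc n) (suc n ∷ τ) → IsAvoider n τ
IsAvoider-max⁻ (isAvoider len (_ ∷ bnd) (n+1∉τ ∷ u) av) =
  isAvoider (suc-injective len) (bounded-drop bnd n+1∉τ) u (avoids-tail av)

IsAvoider-rise⁻ : ∀ {n τ} → IsAvoider (suc (suc n)) (suc n ∷ suc (suc n) ∷ τ) → IsAvoider n τ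
IsAvoider-rise⁻ (isAvoider len (_ ∷ _ ∷ bnd) ((_ ∷ n+1∉τ) ∷ n+2∉τ ∷ u) av) =
  isAvoider (suc-injective (suc-injective len)) (bounded-drop (bounded-drop bnd n+2∉τ) n+1∉τ) u
            (avoids-tail (avoids-tail av))

IsAvoider-head≮ : ∀ {n a ρ} → IsAvoider (suc (suc n)) (a ∷ ρ) → ¬ a < suc n
IsAvoider-head≮ {n} {a} {ρ} av@(isAvoider _ _ _ avaρ) a<n+1
  with pairs-either ρ (∈-tail (IsAvoider-∋ av (s≤s z≤n) (n≤1+n (suc n))) (<⇒≢ a<n+1))
                      (∈-tail (IsAvoider-∋ av (s≤s z≤n) ≤-refl) (<⇒≢ (m≤n⇒m≤1+n a<n+1)))
                      (<⇒≢ (n<1+n (suc n)))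
... | inj₁ 12∈ρ = avoids-∌ avaρ (allowed-123 a<n+1 (n<1+n (suc n))) (triples-∷⁺ a ρ 12∈ρ)
... | inj₂ 21∈ρ = avoids-∌ avaρ (allowed-132 a<n+1 (n<1+n (suc n))) (triples-∷⁺ a ρ 21∈ρ)

IsAvoider-rise-second : ∀ {n b τ} → IsAvoider (suc (suc n)) (suc n ∷ b ∷ τ) → b ≡ suc (suc n)
IsAvoider-rise-second {n} {b} {τ} av@(isAvoider _ (_ ∷ (_ , b≤n+2) ∷ _) ((n+1≢b ∷ _) ∷ _) avn+1bτ)
  with b ≟ suc (suc n)
... | yes b≡n+2 = b≡n+2
... | no  b≢n+2 = contradiction (triples-∷⁺ (suc n) (b ∷ τ) (pairs-∷⁺ b n+2∈τ))
                                (avoids-∌ avn+1bτ (allowed-213 b<n+1 (n<1+n (suc n))))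
  where
  n+2∈τ : suc (suc n) ∈ τ
  n+2∈τ = ∈-tail (∈-tail (IsAvoider-∋ av (s≤s z≤n) ≤-refl) (<⇒≢ (n<1+n (suc n)))) b≢n+2
  b<n+1 : b < suc n
  b<n+1 = s≤s (≤-pred-≢ (≤-pred-≢ b≤n+2 (b≢n+2 ∘ sym)) n+1≢b)

IsAvoider-head : ∀ {n σ} → IsAvoider (suc (suc n)) σ →
                 (∃ λ τ → σ ≡ suc (suc n) ∷ τ) ⊎ (∃ λ τ → σ ≡ suc n ∷ suc (suc n) ∷ τ)
IsAvoider-head {n} {a ∷ ρ} av@(isAvoider _ ((_ , a≤n+2) ∷ _) _ _) with a ≟ suc (suc n) | a ≟ suc n
... | yes refl   | _        = inj₁ (ρ , refl)
... | no a≢n+2   | no a≢n+1 =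
  contradiction (s≤s (≤-pred-≢ (≤-pred-≢ a≤n+2 (a≢n+2 ∘ sym)) (a≢n+1 ∘ sym))) (IsAvoider-head≮ av)
IsAvoider-head {n} {.(suc n) ∷ []} (isAvoider () _ _ _) | no _ | yes refl
IsAvoider-head {n} {.(suc n) ∷ b ∷ τ} av | no _ | yes refl =
  inj₂ (τ , cong (λ b → suc n ∷ b ∷ τ) (IsAvoider-rise-second av))

avoiders : ℕ → List (List ℕ)
avoiders zero          = [] ∷ []
avoiders (suc zero)    = (1 ∷ []) ∷ []
avoiders (suc (suc n)) = map (suc (suc n) ∷_) (avoiders (suc n)) ++ map (λ τ → suc n ∷ suc (suc n) ∷ τ) (avoiders n)

avoiders-unique : ∀ n → Unique (avoiders n)
avoiders-unique zero          = [] ∷ []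
avoiders-unique (suc zero)    = [] ∷ []
avoiders-unique (suc (suc n)) =
  Unique.++⁺ (Unique.map⁺ (proj₂ ∘ ∷-injective) (avoiders-unique (suc n)))
             (Unique.map⁺ (proj₂ ∘ ∷-injective ∘ proj₂ ∘ ∷-injective) (avoiders-unique n))
             different-heads
  where
  different-heads : ∀ {σ} → ¬ (σ ∈ map (suc (suc n) ∷_) (avoiders (suc n)) ×
                                σ ∈ map (λ τ → suc n ∷ suc (suc n) ∷ τ) (avoiders n))
  different-heads (σ∈₁ , σ∈₂) with ∈-map⁻ _ σ∈₁ | ∈-map⁻ _ σ∈₂
  ... | _ , _ , refl | _ , _ , eq = <⇒≢ (n<1+n (suc n)) (sym (proj₁ (∷-injective eq)))

∈-avoiders⇒IsAvoider : ∀ n {σ} → σ ∈ avoiders n → IsAvoider n σ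
∈-avoiders⇒IsAvoider zero          (here refl) = isAvoider refl [] [] (avoids refl)
∈-avoiders⇒IsAvoider (suc zero)    (here refl) = isAvoider refl ((s≤s z≤n , s≤s z≤n) ∷ []) ([] ∷ []) (avoids refl)
∈-avoiders⇒IsAvoider (suc (suc n)) σ∈ with ∈-++⁻ (map (suc (suc n) ∷_) (avoiders (suc n))) σ∈
... | inj₁ σ∈₁ with ∈-map⁻ _ σ∈₁
...   | _ , τ∈ , refl = IsAvoider-max⁺ (∈-avoiders⇒IsAvoider (suc n) τ∈)
∈-avoiders⇒IsAvoider (suc (suc n)) σ∈ | inj₂ σ∈₂ with ∈-map⁻ _ σ∈₂
...   | _ , τ∈ , refl = IsAvoider-rise⁺ (∈-avoiders⇒IsAvoider n τ∈)

IsAvoider⇒∈-avoiders : ∀ n {σ} → IsAvoider n σ → σ ∈ avoiders n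
IsAvoider⇒∈-avoiders zero       {[]}    _ = here refl
IsAvoider⇒∈-avoiders (suc zero) {a ∷ []} (isAvoider _ ((s≤s z≤n , s≤s z≤n) ∷ []) _ _) = here refl
IsAvoider⇒∈-avoiders (suc (suc n)) av with IsAvoider-head av
... | inj₁ (_ , refl) = ∈-++⁺ˡ (∈-map⁺ _ (IsAvoider⇒∈-avoiders (suc n) (IsAvoider-max⁻ av)))
... | inj₂ (_ , refl) = ∈-++⁺ʳ _ (∈-map⁺ _ (IsAvoider⇒∈-avoiders n (IsAvoider-rise⁻ av)))

S∼avoiders : ∀ n {σ} → σ ∈ S n ⇔ σ ∈ avoiders n
S∼avoiders n = mk⇔ (IsAvoider⇒∈-avoiders n ∘ Equivalence.to ∈-S⇔IsAvoider)
                   (Equivalence.from ∈-S⇔IsAvoider ∘ ∈-avoiders⇒IsAvoider n)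

S↭avoiders : ∀ n → S n ↭ avoiders n
S↭avoiders n = ∼bag⇒↭ (unique∧set⇒bag (S-unique n) (avoiders-unique n) (S∼avoiders n))

-- The exponent of q in the identity

exponent : ℕ → ℕ → ℕ
exponent n j = (n ∸ j) *ℕ (n +ℕ j ∸ 1) +ℕ j

exponent-+ : ∀ j d → exponent (j +ℕ d) j ≡ d *ℕ (j +ℕ d +ℕ j ∸ 1) +ℕ j
exponent-+ j d rewrite m+n∸m≡n j d = refl

-- The cases only serve to make the truncated subtraction `∸ 1` compute.
exponent-+-suc : ∀ j d → suc d *ℕ (j +ℕ suc d +ℕ j ∸ 1) +ℕ j
                       ≡ (j +ℕ d) +ℕ (j +ℕ d) +ℕ (d *ℕ (j +ℕ d +ℕ j ∸ 1) +ℕ j)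
exponent-+-suc zero    zero    = refl
exponent-+-suc zero    (suc d) =
  solve 1 (λ d → (con 2 :+ d) :* (con 1 :+ d :+ con 0) :+ con 0
               := (con 1 :+ d) :+ (con 1 :+ d) :+ ((con 1 :+ d) :* (d :+ con 0) :+ con 0)) refl d
  where open +-*-Solver
exponent-+-suc (suc j) d       =
  solve 2 (λ j d → (con 1 :+ d) :* (j :+ (con 1 :+ d) :+ (con 1 :+ j)) :+ (con 1 :+ j)
                 := (con 1 :+ j :+ d) :+ (con 1 :+ j :+ d) :+ (d :* (j :+ d :+ (con 1 :+ j)) :+ (con 1 :+ j))) refl j d
  where open +-*-Solver

exponent-suc : ∀ {j n} → j ≤ n → exponent (suc n) j ≡ (n +ℕ n) +ℕ exponent n j
exponent-suc {j} j≤n with m≤n⇒∃[o]m+o≡n j≤n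
... | d , refl = begin
  exponent (suc (j +ℕ d)) j                                  ≡⟨ cong (λ n → exponent n j) (+-suc j d) ⟨
  exponent (j +ℕ suc d) j                                    ≡⟨ exponent-+ j (suc d) ⟩
  suc d *ℕ (j +ℕ suc d +ℕ j ∸ 1) +ℕ j                        ≡⟨ exponent-+-suc j d ⟩
  (j +ℕ d) +ℕ (j +ℕ d) +ℕ (d *ℕ (j +ℕ d +ℕ j ∸ 1) +ℕ j)    ≡⟨ cong ((j +ℕ d) +ℕ (j +ℕ d) +ℕ_) (exponent-+ j d) ⟨
  (j +ℕ d) +ℕ (j +ℕ d) +ℕ exponent (j +ℕ d) j                ∎
  where open ≡-Reasoning

-- Evaluation in a commutative semiring

module _ {c ℓ} (R : CommutativeSemiring c ℓ) where
  open CommutativeSemiring R renaming (refl to ≈-refl; sym to ≈-sym; trans to ≈-trans)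
  open import Relation.Binary.Reasoning.Setoid setoid
  open import Algebra.Solver.Ring.NaturalCoefficients.Default R

  sumL-↭ : ∀ {xs ys} → xs ↭ ys → sumL R xs ≈ sumL R ys
  sumL-↭ = foldr-commMonoid +-isCommutativeMonoid ∘ ↭⇒↭ₛ′ isEquivalence
    where open SetoidPermutation setoid

  sumL-++ : ∀ xs ys → sumL R (xs ++ ys) ≈ sumL R xs + sumL R ys
  sumL-++ []       ys = ≈-sym (+-identityˡ _)
  sumL-++ (a ∷ xs) ys = ≈-trans (+-congˡ (sumL-++ xs ys)) (≈-sym (+-assoc _ _ _))

  module _ {A : Set} where

    sumL-cong : ∀ {f g : A → Carrier} xs → (∀ {j} → j ∈ xs → f j ≈ g j) → sumL R (map f xs) ≈ sumL R (map g xs)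
    sumL-cong []       _   = ≈-refl
    sumL-cong (a ∷ xs) f≈g = +-cong (f≈g (here refl)) (sumL-cong xs (f≈g ∘ there))

    *-distribˡ-sumL : ∀ k (f : A → Carrier) xs → k * sumL R (map f xs) ≈ sumL R (map (λ j → k * f j) xs)
    *-distribˡ-sumL k f []       = zeroʳ k
    *-distribˡ-sumL k f (a ∷ xs) = ≈-trans (distribˡ k _ _) (+-congˡ (*-distribˡ-sumL k f xs))

  sumL-upTo-suc : ∀ (f : ℕ → Carrier) n → sumL R (map f (upTo (suc n))) ≈ sumL R (map f (upTo n)) + f n
  sumL-upTo-suc f n = begin
    sumL R (map f (upTo (suc n)))          ≡⟨ cong (sumL R ∘ map f) (upTo-∷ʳ n) ⟨
    sumL R (map f (upTo n ++ n ∷ []))      ≡⟨ cong (sumL R) (map-++ f (upTo n) (n ∷ [])) ⟩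
    sumL R (map f (upTo n) ++ f n ∷ [])    ≈⟨ sumL-++ (map f (upTo n)) (f n ∷ []) ⟩
    sumL R (map f (upTo n)) + (f n + 0#)   ≈⟨ +-congˡ (+-identityʳ (f n)) ⟩
    sumL R (map f (upTo n)) + f n          ∎

  pow-+ : ∀ a m n → pow R a (m +ℕ n) ≈ pow R a m * pow R a n
  pow-+ a zero    n = ≈-sym (*-identityˡ _)
  pow-+ a (suc m) n = ≈-trans (*-congˡ (pow-+ a m n)) (≈-sym (*-assoc _ _ _))

  module _ (x y q : Carrier) where

    weight : List ℕ → Carrier
    weight π = pow R x (sstat π) * pow R y (dstat π) * pow R q (inv π)

    weight-max-∷ : ∀ {m τ} → All (_< m) τ → weight (m ∷ τ) ≈ x * pow R q (length τ) * weight τ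
    weight-max-∷ {m} {τ} τ<m rewrite runs-max-∷ τ<m | inv-max-∷ τ<m = begin
      x * X * Y * pow R q (length τ +ℕ inv τ)  ≈⟨ *-congˡ (pow-+ q (length τ) (inv τ)) ⟩
      x * X * Y * (Q * I)
        ≈⟨ solve 5 (λ x X Y Q I → x :* X :* Y :* (Q :* I) := x :* Q :* (X :* Y :* I)) ≈-refl x X Y Q I ⟩
      x * Q * (X * Y * I)                      ∎
      where
      X = pow R x (sstat τ)
      Y = pow R y (dstat τ)
      Q = pow R q (length τ)
      I = pow R q (inv τ)

    weight-rise-∷ : ∀ {k τ} → All (_< k) τ → weight (k ∷ suc k ∷ τ) ≈ y * pow R q (length τ +ℕ length τ) * weight τ
    weight-rise-∷ {k} {τ} τ<k rewrite runs-rise-∷ (All.map m≤n⇒m≤1+n τ<k) | inv-rise-∷ τ<k = begin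
      X * (y * Y) * pow R q (length τ +ℕ (length τ +ℕ inv τ))
        ≈⟨ *-congˡ (≈-trans (pow-+ q (length τ) _) (*-congˡ (pow-+ q (length τ) (inv τ)))) ⟩
      X * (y * Y) * (Q * (Q * I))
        ≈⟨ solve 5 (λ y X Y Q I → X :* (y :* Y) :* (Q :* (Q :* I)) := y :* (Q :* Q) :* (X :* Y :* I)) ≈-refl y X Y Q I ⟩
      y * (Q * Q) * (X * Y * I)
        ≈⟨ *-congʳ (*-congˡ (pow-+ q (length τ) (length τ))) ⟨
      y * pow R q (length τ +ℕ length τ) * weight τ
        ∎
      where
      X = pow R x (sstat τ)
      Y = pow R y (dstat τ)
      Q = pow R q (length τ)
      I = pow R q (inv τ)

    FI≈sum-avoiders : ∀ n → FI R n x y q ≈ sumL R (map weight (avoiders n))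
    FI≈sum-avoiders n = sumL-↭ (map⁺ weight (S↭avoiders n))

    FI-0 : FI R 0 x y q ≈ 1#
    FI-0 = ≈-trans (FI≈sum-avoiders 0) (solve 0 (con 1 :* con 1 :* con 1 :+ con 0 := con 1) ≈-refl)

    FI-1 : FI R 1 x y q ≈ x
    FI-1 = ≈-trans (FI≈sum-avoiders 1) (solve 1 (λ x → x :* con 1 :* con 1 :* con 1 :+ con 0 := x) ≈-refl x)

    FI-rec : ∀ n → FI R (suc (suc n)) x y q ≈ x * pow R q (suc n) * FI R (suc n) x y q + y * pow R q (n +ℕ n) * FI R n x y q
    FI-rec n = begin
      FI R (suc (suc n)) x y q
        ≈⟨ FI≈sum-avoiders (suc (suc n)) ⟩
      sumL R (map weight (map max A₁ ++ map rise A₀))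
        ≡⟨ cong (sumL R) (map-++ weight (map max A₁) (map rise A₀)) ⟩
      sumL R (map weight (map max A₁) ++ map weight (map rise A₀))
        ≈⟨ sumL-++ (map weight (map max A₁)) (map weight (map rise A₀)) ⟩
      sumL R (map weight (map max A₁)) + sumL R (map weight (map rise A₀))
        ≡⟨ cong₂ (λ l l′ → sumL R l + sumL R l′) (map-∘ A₁) (map-∘ A₀) ⟨
      sumL R (map (weight ∘ max) A₁) + sumL R (map (weight ∘ rise) A₀)
        ≈⟨ +-cong (sumL-cong A₁ max-step) (sumL-cong A₀ rise-step) ⟩
      sumL R (map (λ τ → X * weight τ) A₁) + sumL R (map (λ τ → Y * weight τ) A₀)
        ≈⟨ +-cong (*-distribˡ-sumL X weight A₁) (*-distribˡ-sumL Y weight A₀) ⟨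
      X * sumL R (map weight A₁) + Y * sumL R (map weight A₀)
        ≈⟨ +-cong (*-congˡ (FI≈sum-avoiders (suc n))) (*-congˡ (FI≈sum-avoiders n)) ⟨
      X * FI R (suc n) x y q + Y * FI R n x y q
        ∎
      where
      A₁ = avoiders (suc n)
      A₀ = avoiders n
      X = x * pow R q (suc n)
      Y = y * pow R q (n +ℕ n)
      max rise : List ℕ → List ℕ
      max τ = suc (suc n) ∷ τ
      rise τ = suc n ∷ suc (suc n) ∷ τ
      max-step : ∀ {τ} → τ ∈ A₁ → weight (max τ) ≈ X * weight τ
      max-step {τ} τ∈ with ∈-avoiders⇒IsAvoider (suc n) τ∈
      ... | isAvoider len bnd _ _ =
        ≈-trans (weight-max-∷ (bounded-below bnd)) (reflexive (cong (λ l → x * pow R q l * weight τ) len))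
      rise-step : ∀ {τ} → τ ∈ A₀ → weight (rise τ) ≈ Y * weight τ
      rise-step {τ} τ∈ with ∈-avoiders⇒IsAvoider n τ∈
      ... | isAvoider len bnd _ _ =
        ≈-trans (weight-rise-∷ (bounded-below bnd)) (reflexive (cong (λ l → y * pow R q (l +ℕ l) * weight τ) len))

  module _ (x y q : Carrier) (F : ℕ → Carrier) (F-0 : F 0 ≈ 1#) (F-1 : F 1 ≈ x)
           (F-rec : ∀ n → F (suc (suc n)) ≈ x * pow R q (suc n) * F (suc n) + y * pow R q (n +ℕ n) * F n) where

    term : ℕ → ℕ → Carrier
    term n j = x * pow R y (n ∸ j) * pow R q (exponent n j) * (F j * F j)

    term-diagonal : ∀ n → term n n ≈ x * pow R q n * (F n * F n)
    term-diagonal n rewrite n∸n≡0 n =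
      solve 3 (λ x Q A → x :* con 1 :* Q :* A := x :* Q :* A) ≈-refl x (pow R q n) (F n * F n)

    term-suc : ∀ {n j} → j ≤ n → y * pow R q (n +ℕ n) * term n j ≈ term (suc n) j
    term-suc {n} {j} j≤n = begin
      y * Q * (x * Y * E * A)
        ≈⟨ solve 6 (λ y Q x Y E A → y :* Q :* (x :* Y :* E :* A) := x :* (y :* Y) :* (Q :* E) :* A) ≈-refl y Q x Y E A ⟩
      x * (y * Y) * (Q * E) * A
        ≈⟨ *-congʳ (*-congˡ (pow-+ q (n +ℕ n) (exponent n j))) ⟨
      x * pow R y (suc (n ∸ j)) * pow R q (n +ℕ n +ℕ exponent n j) * A
        ≡⟨ cong₂ (λ a b → x * pow R y a * pow R q b * A) (+-∸-assoc 1 j≤n) (exponent-suc j≤n) ⟨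
      term (suc n) j
        ∎
      where
      Q = pow R q (n +ℕ n)
      Y = pow R y (n ∸ j)
      E = pow R q (exponent n j)
      A = F j * F j

    product-identity : ∀ n → F (suc n) * F n ≈ sumL R (map (term n) (upTo (suc n)))
    product-identity zero = begin
      F 1 * F 0
        ≈⟨ *-cong F-1 F-0 ⟩
      x * 1#
        ≈⟨ solve 1 (λ x → x :* con 1 := x :* con 1 :* con 1 :* (con 1 :* con 1) :+ con 0) ≈-refl x ⟩
      x * 1# * 1# * (1# * 1#) + 0#
        ≈⟨ +-congʳ (*-congˡ (*-cong F-0 F-0)) ⟨
      sumL R (map (term 0) (upTo 1))
        ∎
    product-identity (suc n) = begin
      F (suc (suc n)) * F (suc n)
        ≈⟨ *-congʳ (F-rec n) ⟩
      (X * F (suc n) + Y * F n) * F (suc n)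
        ≈⟨ solve 4 (λ X Y A B → (X :* A :+ Y :* B) :* A := Y :* (A :* B) :+ X :* (A :* A)) ≈-refl X Y (F (suc n)) (F n) ⟩
      Y * (F (suc n) * F n) + X * (F (suc n) * F (suc n))
        ≈⟨ +-cong (*-congˡ (product-identity n)) (≈-sym (term-diagonal (suc n))) ⟩
      Y * sumL R (map (term n) (upTo (suc n))) + term (suc n) (suc n)
        ≈⟨ +-congʳ (*-distribˡ-sumL Y (term n) (upTo (suc n))) ⟩
      sumL R (map (λ j → Y * term n j) (upTo (suc n))) + term (suc n) (suc n)
        ≈⟨ +-congʳ (sumL-cong (upTo (suc n)) (term-suc ∘ ≤-pred ∘ ∈-upTo⁻)) ⟩
      sumL R (map (term (suc n)) (upTo (suc n))) + term (suc n) (suc n)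
        ≈⟨ sumL-upTo-suc (term (suc n)) (suc n) ⟨
      sumL R (map (term (suc n)) (upTo (suc (suc n))))
        ∎
      where
      X = x * pow R q (suc n)
      Y = y * pow R q (n +ℕ n)

theorem4p7 : ∀ {c ℓ} (R : CommutativeSemiring c ℓ) → let open CommutativeSemiring R in
    ∀ (n : ℕ) (x y q : Carrier) →
      FI R (suc n) x y q * FI R n x y q
        ≈ sumL R (map (λ j → x * pow R y (n ∸ j) * pow R q ((n ∸ j) *ℕ (n +ℕ j ∸ 1) +ℕ j)
                              * (FI R j x y q * FI R j x y q))
                      (upTo (suc n)))
theorem4p7 R n x y q =
  product-identity R x y q (λ j → FI R j x y q) (FI-0 R x y q) (FI-1 R x y q) (FI-rec R x y q) n
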